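{- Let $k\ge2$, $N\ge1$ and $n=\lfloor\log_k(N(k-1)+1)\rfloor$. For every integer $i$ with $0\le i\le n-1$, \[f_i(N,k)=f_0\!\left(\left\lfloor \frac{N-\frac{k^n-1}{k-1}}{k^i}\right\rfloor+\frac{k^{n-i}-1}{k-1},\;k\right).\]
   Context: Fix an integer $k\ge 2$. Let $T_k$ be the infinite rooted $k$-ary tree (every vertex has exactly $k$ children) with one additional self-loop at the root, so every vertex has degree $k+1$. A vertex is on layer $i+1$ if its distance from the root is $i$ (the root is on layer 1). Chip-firing: a vertex with at least $k+1$ chips may fire, sending one chip along each incident edge (a non-root vertex sends one chip to its parent and one to each of its $k$ children; the root sends one chip to each of its $k$ children and one chip to itself along the self-loop). Starting with $N$ chips at the root and none elsewhere, vertices fire until no vertex can fire; this terminates, and the number of times each vertex fires does not depend on the order of firings. All vertices on the same layer fire the same number of times; $f_i(N,k)$ denotes the number of times each vertex of layer $i+1$ fires (so $f_0(N,k)$ is the number of root fires). -}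

module Defs where

open import Data.Nat using (ℕ; zero; suc; s≤s; z≤n; _+_; _*_; _∸_; _^_; _≤_; _<_; NonZero; _/_)
open import Data.Nat.Properties using (m^n≢0)
open import Data.Fin using (Fin)
import Data.Fin.Properties as FinP
open import Data.List using (List; []; _∷_; length; filter)
import Data.List.Properties as ListP
open import Data.Bool using (Bool; true; false; if_then_else_)
open import Relation.Nullary using (does; Dec)
open import Relation.Binary.PropositionalEquality using (_≡_)

-- Vertices of the infinite rooted k-ary tree T_k: addresses (paths from the
-- root), most recent step first.  [] is the root; the children of v are j ∷ v
-- (j : Fin k); the parent of j ∷ v is v.  A vertex v is on layer (length v + 1).
Vertex : ℕ → Set
Vertex k = List (Fin k)

_≟V_ : ∀ {k} (v w : Vertex k) → Dec (v ≡ w)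
_≟V_ = ListP.≡-dec FinP._≟_

Config : ℕ → Set
Config k = Vertex k → ℕ

isChildOf : ∀ {k} → Vertex k → Vertex k → Bool
isChildOf []      v = false
isChildOf (_ ∷ w) v = does (w ≟V v)

isRoot : ∀ {k} → Vertex k → Bool
isRoot []      = true
isRoot (_ ∷ _) = false

b2n : Bool → ℕ
b2n true  = 1
b2n false = 0

-- number of chips vertex w receives when v fires: one along each edge
-- from v to w (w child of v, w parent of v, or the root self-loop).
gain : ∀ {k} → Vertex k → Vertex k → ℕ
gain v w = b2n (isChildOf w v) + b2n (isChildOf v w)
         + b2n (if isRoot v then isRoot w else false)

-- firing v: v loses k+1 chips (one per incident edge, self-loop included),
-- and every vertex receives its share.
fire : ∀ {k} → Config k → Vertex k → Config k
fire {k} c v w =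
  (if does (v ≟V w) then c w ∸ suc k else c w) + gain v w

data Fires {k : ℕ} : Config k → List (Vertex k) → Config k → Set where
  done : ∀ {c} → Fires c [] c
  step : ∀ {c v vs c'} → suc k ≤ c v → Fires (fire c v) vs c' → Fires c (v ∷ vs) c'

Stable : ∀ {k} → Config k → Set
Stable {k} c = ∀ v → c v < suc k

initial : ∀ {k} → ℕ → Config k
initial N []      = N
initial N (_ ∷ _) = 0

count : ∀ {k} → Vertex k → List (Vertex k) → ℕ
count v vs = length (filter (v ≟V_) vs)

private
  nz1 : ∀ {k} → 2 ≤ k → NonZero (k ∸ 1)
  nz1 {suc (suc k)} (s≤s (s≤s z≤n)) = _

  nz0 : ∀ {k} → 2 ≤ k → NonZero k
  nz0 {suc (suc k)} (s≤s (s≤s z≤n)) = _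

repunit : (k : ℕ) → 2 ≤ k → ℕ → ℕ
repunit k hk n = _/_ (k ^ n ∸ 1) (k ∸ 1) {{nz1 hk}}

divPow : (k : ℕ) → 2 ≤ k → ℕ → ℕ → ℕ
divPow k hk a i = _/_ a (k ^ i) {{m^n≢0 k i {{nz0 hk}}}}

-- Least action principle: the firing vector of a stabilisation is the least
-- supersolution, i.e. the least y such that firing every vertex w exactly y w
-- times would leave at most k chips everywhere.
--
-- Put share x = ⌊(x − 1)/k⌋ and odometer x = share x + odometer (share x). The
-- profile giving a vertex at depth i the value odometer (shareⁱ N) is a
-- supersolution, since x ≤ k · share x + k. Conversely every supersolution y
-- dominates it: if x chips reach a vertex w net from above, then at least
-- share x reach its child with the fewest firings, so y w ≥ share x + share² x
-- + ⋯ = odometer x. Hence f_i(N) = odometer (shareⁱ N) and f_0(M) = odometer M.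
--
-- Finally R m = (kᵐ − 1)/(k − 1) satisfies R (m + 1) = 1 + k R m, so
-- share (q + R (m + 1)) = ⌊q/k⌋ + R m, and by induction
-- shareⁱ N = ⌊(N − R n)/kⁱ⌋ + R (n − i).
module Submission where

open import Defs
open import Data.Nat
  using (ℕ; zero; suc; _+_; _*_; _∸_; _^_; _≤_; _<_; s≤s; z≤n; _/_; _%_; NonZero; _≤?_)
open import Data.Nat.Properties
open import Data.Nat.DivMod
open import Data.Nat.Divisibility using (n∣m*n)
open import Data.Nat.GeneralisedArithmetic using (fold)
open import Data.Nat.Tactic.RingSolver using (solve-∀)
open import Data.Fin using (Fin; zero; suc; punchIn)
open import Data.Fin.Properties using (punchInᵢ≢i)
open import Data.List using (List; []; _∷_; length)
open import Data.List.Properties using (∷-injectiveˡ; ∷-injectiveʳ)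
open import Data.Bool using (true; false)
open import Data.Product using (∃; _,_)
open import Function using (_∘_)
open import Relation.Nullary using (does; yes; no)
open import Relation.Nullary.Decidable using (dec-true; dec-false)
open import Relation.Binary.PropositionalEquality
open import Algebra.Properties.CommutativeMonoid.Sum +-0-commutativeMonoid
  using (sum; sum-syntax; sum-cong-≗; ∑-distrib-+; sum-remove; sum-replicate-zero)
open import Algebra.Properties.CommutativeSemigroup +-commutativeSemigroup
  using (interchange; xy∙z≈xz∙y; xy∙z≈y∙xz; x∙yz≈xz∙y; x∙yz≈yx∙z; x∙yz≈y∙xz)

∑-const : ∀ n c → ∑[ j < n ] c ≡ n * c
∑-const zero    c = refl
∑-const (suc n) c = cong (c +_) (∑-const n c)

∑-zero : ∀ {n} {f : Fin n → ℕ} → (∀ j → f j ≡ 0) → sum f ≡ 0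
∑-zero {n} f≗0 = trans (sum-cong-≗ f≗0) (sum-replicate-zero n)

∑-indicator : ∀ {n} (i : Fin n) {f : Fin n → ℕ} →
              f i ≡ 1 → (∀ j → j ≢ i → f j ≡ 0) → sum f ≡ 1
∑-indicator {suc n} i {f} fi≡1 f≡0 = begin
  sum f                               ≡⟨ sum-remove {i = i} f ⟩
  f i + ∑[ j < n ] f (punchIn i j)    ≡⟨ cong₂ _+_ fi≡1 (∑-zero (λ j → f≡0 _ (punchInᵢ≢i i j))) ⟩
  1                                   ∎
  where open ≡-Reasoning

∃-below-average : ∀ {n} .{{_ : NonZero n}} (f : Fin n → ℕ) → ∃ λ j → n * f j ≤ sum f
∃-below-average {suc zero}    f = zero , ≤-refl
∃-below-average {suc (suc n)} f with ∃-below-average (f ∘ suc)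
... | j , n*fj≤∑ with f zero ≤? f (suc j)
...   | yes f₀≤fj = zero  , +-monoʳ-≤ (f zero) (≤-trans (*-monoʳ-≤ (suc n) f₀≤fj) n*fj≤∑)
...   | no  f₀≰fj = suc j , +-mono-≤ (<⇒≤ (≰⇒> f₀≰fj)) n*fj≤∑

allOnes : ℕ → ℕ → ℕ
allOnes b zero    = 0
allOnes b (suc m) = 1 + b * allOnes b m

[1+k]^m≡1+allOnes*k : ∀ k m → suc k ^ m ≡ 1 + allOnes (suc k) m * k
[1+k]^m≡1+allOnes*k k zero    = refl
[1+k]^m≡1+allOnes*k k (suc m) =
  trans (cong (suc k *_) ([1+k]^m≡1+allOnes*k k m)) (expand k (allOnes (suc k) m))
  where
  expand : ∀ k r → (1 + k) * (1 + r * k) ≡ 1 + (1 + (1 + k) * r) * k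
  expand = solve-∀

allOnes-≤ : ∀ {k N n} .{{_ : NonZero k}} → suc k ^ n ≤ N * k + 1 → allOnes (suc k) n ≤ N
allOnes-≤ {k} {N} {n} k^n≤ = *-cancelʳ-≤ _ N k
  (≤-pred (subst₂ _≤_ ([1+k]^m≡1+allOnes*k k n) (+-comm (N * k) 1) k^n≤))

repunit≡allOnes : ∀ {k} (hk : 2 ≤ k) m → repunit k hk m ≡ allOnes k m
repunit≡allOnes {suc (suc k)} (s≤s (s≤s z≤n)) m =
  trans (cong (λ x → (x ∸ 1) / suc k) ([1+k]^m≡1+allOnes*k (suc k) m))
        (m*n/n≡m (allOnes (suc (suc k)) m) (suc k))

module _ {k : ℕ} where

  δ : Vertex k → Vertex k → ℕ
  δ u v = b2n (does (v ≟V u))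

  δ-self : ∀ u → δ u u ≡ 1
  δ-self u rewrite dec-true (u ≟V u) refl = refl

  δ-other : ∀ {u v} → v ≢ u → δ u v ≡ 0
  δ-other {u} {v} v≢u rewrite dec-false (v ≟V u) v≢u = refl

  δ-≤ : ∀ {u} {y : Vertex k → ℕ} → 1 ≤ y u → ∀ v → δ u v ≤ y v
  δ-≤ {u} {y} 1≤yu v with v ≟V u
  ... | yes refl = 1≤yu
  ... | no  _    = z≤n

  count-∷ : ∀ v u vs → count v (u ∷ vs) ≡ δ u v + count v vs
  count-∷ v u vs with does (v ≟V u)
  ... | true  = refl
  ... | false = refl

  counts : List (Vertex k) → Vertex k → ℕ
  counts vs v = count v vs

  -- The self-loop at the root is modelled by making the root its own parent.
  parent : Vertex k → Vertex k
  parent []      = []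
  parent (_ ∷ v) = v

  inflow : (Vertex k → ℕ) → Vertex k → ℕ
  inflow y w = y (parent w) + ∑[ j < k ] y (j ∷ w)

  inflow-cong : ∀ {y z} → (∀ v → y v ≡ z v) → ∀ w → inflow y w ≡ inflow z w
  inflow-cong y≗z w = cong₂ _+_ (y≗z (parent w)) (sum-cong-≗ (λ j → y≗z (j ∷ w)))

  ∑-δ-children : ∀ u w → ∑[ j < k ] δ u (j ∷ w) ≡ b2n (isChildOf u w)
  ∑-δ-children []      w = ∑-zero (λ j → δ-other {u = []} {j ∷ w} (λ ()))
  ∑-δ-children (i ∷ q) w with q ≟V w
  ... | yes refl =
    ∑-indicator i (δ-self (i ∷ q)) (λ j j≢i → δ-other {v = j ∷ q} (j≢i ∘ ∷-injectiveˡ))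
  ... | no  q≢w  = ∑-zero (λ j → δ-other {v = j ∷ w} (q≢w ∘ sym ∘ ∷-injectiveʳ))

  inflow-δ : ∀ u w → inflow (δ u) w ≡ gain u w
  inflow-δ []      []      rewrite ∑-δ-children [] []            = refl
  inflow-δ (i ∷ q) []      rewrite ∑-δ-children (i ∷ q) []       = sym (+-identityʳ _)
  inflow-δ []      (j ∷ p) rewrite ∑-δ-children [] (j ∷ p)       = sym (+-identityʳ _)
  inflow-δ (i ∷ q) (j ∷ p) rewrite ∑-δ-children (i ∷ q) (j ∷ p)  = sym (+-identityʳ _)

  inflow-δ-+ : ∀ u y w → inflow (λ v → δ u v + y v) w ≡ gain u w + inflow y w
  inflow-δ-+ u y w = begin
    δ u (parent w) + y (parent w) + ∑[ j < k ] (δ u (j ∷ w) + y (j ∷ w))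
      ≡⟨ cong (δ u (parent w) + y (parent w) +_) (∑-distrib-+ (δ u ∘ (_∷ w)) (y ∘ (_∷ w))) ⟩
    δ u (parent w) + y (parent w) + (∑[ j < k ] δ u (j ∷ w) + ∑[ j < k ] y (j ∷ w))
      ≡⟨ interchange (δ u (parent w)) (y (parent w)) _ _ ⟩
    inflow (δ u) w + inflow y w
      ≡⟨ cong (_+ inflow y w) (inflow-δ u w) ⟩
    gain u w + inflow y w
      ∎
    where open ≡-Reasoning

  fire-balance : ∀ {c : Config k} {u} → suc k ≤ c u →
                 ∀ w → fire c u w + suc k * δ u w ≡ c w + gain u w
  fire-balance {c} {u} k<cu w with u ≟V w
  ... | yes refl rewrite δ-self u = begin
    c u ∸ suc k + gain u u + suc k * 1   ≡⟨ cong (c u ∸ suc k + gain u u +_) (*-identityʳ (suc k)) ⟩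
    c u ∸ suc k + gain u u + suc k       ≡⟨ xy∙z≈xz∙y (c u ∸ suc k) _ _ ⟩
    c u ∸ suc k + suc k + gain u u       ≡⟨ cong (_+ gain u u) (m∸n+n≡m k<cu) ⟩
    c u + gain u u                       ∎
    where open ≡-Reasoning
  ... | no u≢w rewrite δ-other (u≢w ∘ sym) | *-zeroʳ k = +-identityʳ _

  conservation : ∀ {c vs c′} → Fires c vs c′ →
                 ∀ w → c′ w + suc k * count w vs ≡ c w + inflow (counts vs) w
  conservation {c} done w = cong (c w +_) (trans (*-zeroʳ k) (sym (∑-zero {k} (λ _ → refl))))
  conservation {c} {u ∷ vs} {c′} (step k<cu fires) w = begin
    c′ w + suc k * count w (u ∷ vs)
      ≡⟨ cong (λ n → c′ w + suc k * n) (count-∷ w u vs) ⟩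
    c′ w + suc k * (δ u w + count w vs)
      ≡⟨ cong (c′ w +_) (*-distribˡ-+ (suc k) (δ u w) _) ⟩
    c′ w + (suc k * δ u w + suc k * count w vs)
      ≡⟨ x∙yz≈xz∙y (c′ w) (suc k * δ u w) (suc k * count w vs) ⟩
    c′ w + suc k * count w vs + suc k * δ u w
      ≡⟨ cong (_+ suc k * δ u w) (conservation fires w) ⟩
    fire c u w + inflow (counts vs) w + suc k * δ u w
      ≡⟨ xy∙z≈xz∙y (fire c u w) (inflow (counts vs) w) (suc k * δ u w) ⟩
    fire c u w + suc k * δ u w + inflow (counts vs) w
      ≡⟨ cong (_+ inflow (counts vs) w) (fire-balance {c} k<cu w) ⟩
    c w + gain u w + inflow (counts vs) w
      ≡⟨ +-assoc (c w) _ _ ⟩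
    c w + (gain u w + inflow (counts vs) w)
      ≡⟨ cong (c w +_) (inflow-δ-+ u (counts vs) w) ⟨
    c w + inflow (λ v → δ u v + count v vs) w
      ≡⟨ cong (c w +_) (inflow-cong (λ v → count-∷ v u vs) w) ⟨
    c w + inflow (counts (u ∷ vs)) w
      ∎
    where open ≡-Reasoning

  -- Firing every w exactly y w times from c, legally or not, would end in a
  -- stable configuration.
  Supersolution : Config k → (Vertex k → ℕ) → Set
  Supersolution c y = ∀ w → c w + inflow y w ≤ suc k * y w + k

  supersolution-resp : ∀ {c y z} → (∀ v → y v ≡ z v) → Supersolution c y → Supersolution c z
  supersolution-resp {c} y≗z sup w =
    subst₂ (λ a b → c w + a ≤ suc k * b + k) (inflow-cong y≗z w) (y≗z w) (sup w)

  stable⇒supersolution : ∀ {c vs c′} → Fires c vs c′ → Stable c′ → Supersolution c (counts vs)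
  stable⇒supersolution {c} {vs} {c′} fires stable w = begin
    c w + inflow (counts vs) w      ≡⟨ conservation fires w ⟨
    c′ w + suc k * count w vs       ≤⟨ +-monoˡ-≤ _ (≤-pred (stable w)) ⟩
    k + suc k * count w vs          ≡⟨ +-comm k _ ⟩
    suc k * count w vs + k          ∎
    where open ≤-Reasoning

  supersolution-positive : ∀ {c y u} → suc k ≤ c u → Supersolution c y → 1 ≤ y u
  supersolution-positive {c} {y} {u} k<cu sup = n≢0⇒n>0 λ yu≡0 → <⇒≱ k<cu (begin
    c u                         ≤⟨ m≤m+n (c u) _ ⟩
    c u + inflow y u            ≤⟨ sup u ⟩
    suc k * y u + k             ≡⟨ cong (λ n → suc k * n + k) yu≡0 ⟩
    suc k * 0 + k               ≡⟨ cong (_+ k) (*-zeroʳ k) ⟩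
    k                           ∎)
    where open ≤-Reasoning

  fire-supersolution : ∀ {c u y} → suc k ≤ c u →
                       Supersolution c (λ v → δ u v + y v) → Supersolution (fire c u) y
  fire-supersolution {c} {u} {y} k<cu sup w = +-cancelˡ-≤ (suc k * δ u w) _ _ (begin
    suc k * δ u w + (fire c u w + inflow y w)   ≡⟨ x∙yz≈yx∙z (suc k * δ u w) (fire c u w) _ ⟩
    fire c u w + suc k * δ u w + inflow y w     ≡⟨ cong (_+ inflow y w) (fire-balance {c} k<cu w) ⟩
    c w + gain u w + inflow y w                 ≡⟨ +-assoc (c w) _ _ ⟩
    c w + (gain u w + inflow y w)               ≡⟨ cong (c w +_) (inflow-δ-+ u y w) ⟨
    c w + inflow (λ v → δ u v + y v) w          ≤⟨ sup w ⟩
    suc k * (δ u w + y w) + k                   ≡⟨ cong (_+ k) (*-distribˡ-+ (suc k) (δ u w) _) ⟩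
    suc k * δ u w + suc k * y w + k             ≡⟨ +-assoc (suc k * δ u w) _ _ ⟩
    suc k * δ u w + (suc k * y w + k)           ∎)
    where open ≤-Reasoning

  least-action : ∀ {c vs c′ y} → Fires c vs c′ → Supersolution c y → ∀ v → count v vs ≤ y v
  least-action done _ v = z≤n
  least-action {c} {u ∷ vs} {y = y} (step k<cu fires) sup v = begin
    count v (u ∷ vs)             ≡⟨ count-∷ v u vs ⟩
    δ u v + count v vs           ≤⟨ +-monoʳ-≤ (δ u v) (least-action fires sup′ v) ⟩
    δ u v + (y v ∸ δ u v)        ≡⟨ y-split v ⟩
    y v                          ∎
    where
    open ≤-Reasoning
    y-split : ∀ v → δ u v + (y v ∸ δ u v) ≡ y v
    y-split = m+[n∸m]≡n ∘ δ-≤ (supersolution-positive {c} k<cu sup)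
    sup′ : Supersolution (fire c u) (λ v → y v ∸ δ u v)
    sup′ = fire-supersolution {c} k<cu (supersolution-resp {c} (sym ∘ y-split) sup)

module Odometer (k : ℕ) .{{_ : NonZero k}} where

  share : ℕ → ℕ
  share x = (x ∸ 1) / k

  share-0 : share 0 ≡ 0
  share-0 = 0/n≡0 k

  k*share≤pred : ∀ x → k * share x ≤ x ∸ 1
  k*share≤pred x = subst (_≤ x ∸ 1) (*-comm (share x) k) (m/n*n≤m (x ∸ 1) k)

  share≤pred : ∀ x → share x ≤ x ∸ 1
  share≤pred x = ≤-trans (m≤n*m (share x) k) (k*share≤pred x)

  ≤k*share+k : ∀ x → x ≤ k * share x + k
  ≤k*share+k x = begin
    x                                      ≤⟨ m≤n+m∸n x 1 ⟩
    1 + (x ∸ 1)                            ≡⟨ cong suc (m≡m%n+[m/n]*n (x ∸ 1) k) ⟩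
    suc ((x ∸ 1) % k) + share x * k        ≤⟨ +-monoˡ-≤ _ (m%n<n (x ∸ 1) k) ⟩
    k + share x * k                        ≡⟨ +-comm k _ ⟩
    share x * k + k                        ≡⟨ cong (_+ k) (*-comm (share x) k) ⟩
    k * share x + k                        ∎
    where open ≤-Reasoning

  share-+-≤ : ∀ {x m y} → suc x + k * m ≤ k * y + k → share (suc x) + m ≤ y
  share-+-≤ {x} {m} {y} x+km≤ = <⇒≤pred (*-cancelˡ-< k _ _ (begin-strict
    k * (share (suc x) + m)                ≡⟨ *-distribˡ-+ k (share (suc x)) m ⟩
    k * share (suc x) + k * m              ≤⟨ +-monoˡ-≤ _ (k*share≤pred (suc x)) ⟩
    x + k * m                              <⟨ n<1+n _ ⟩
    suc x + k * m                          ≤⟨ x+km≤ ⟩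
    k * y + k                              ≡⟨ +-comm (k * y) k ⟩
    k + k * y                              ≡⟨ *-suc k y ⟨
    k * suc y                              ∎))
    where open ≤-Reasoning

  -- odometer x = ∑_{j ≥ 1} share^j x, a sum with fewer than x nonzero terms.
  odometerWithin : ℕ → ℕ → ℕ
  odometerWithin zero    x = 0
  odometerWithin (suc b) x = share x + odometerWithin b (share x)

  odometer : ℕ → ℕ
  odometer x = odometerWithin x x

  odometerWithin-0 : ∀ b → odometerWithin b 0 ≡ 0
  odometerWithin-0 zero    = refl
  odometerWithin-0 (suc b) rewrite share-0 = odometerWithin-0 b

  odometerWithin-fuel : ∀ {x} b b′ → x ≤ b → x ≤ b′ → odometerWithin b x ≡ odometerWithin b′ x
  odometerWithin-fuel zero    b′       z≤n _   = sym (odometerWithin-0 b′)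
  odometerWithin-fuel (suc b) zero     _   z≤n = odometerWithin-0 (suc b)
  odometerWithin-fuel {x} (suc b) (suc b′) x≤b x≤b′ =
    cong (share x +_) (odometerWithin-fuel b b′ (bound x≤b) (bound x≤b′))
    where
    bound : ∀ {c} → x ≤ suc c → share x ≤ c
    bound = ≤-trans (share≤pred x) ∘ ∸-monoˡ-≤ 1

  odometer-unfold : ∀ x → odometer x ≡ share x + odometer (share x)
  odometer-unfold zero    rewrite share-0 = refl
  odometer-unfold (suc x) =
    cong (share (suc x) +_) (odometerWithin-fuel x _ (share≤pred (suc x)) ≤-refl)

  odometer-balance : ∀ x → x + odometer x + k * odometer (share x) ≤ suc k * odometer x + k
  odometer-balance x = begin
    x + F + k * G                ≡⟨ xy∙z≈y∙xz x F (k * G) ⟩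
    F + (x + k * G)              ≤⟨ +-monoʳ-≤ F (+-monoˡ-≤ (k * G) (≤k*share+k x)) ⟩
    F + (k * share x + k + k * G) ≡⟨ cong (F +_) (xy∙z≈xz∙y (k * share x) k (k * G)) ⟩
    F + (k * share x + k * G + k) ≡⟨ cong (λ n → F + (n + k)) (*-distribˡ-+ k (share x) G) ⟨
    F + (k * (share x + G) + k)  ≡⟨ cong (λ n → F + (k * n + k)) (odometer-unfold x) ⟨
    F + (k * F + k)              ≡⟨ +-assoc F (k * F) k ⟨
    suc k * F + k                ∎
    where
    open ≤-Reasoning
    F = odometer x
    G = odometer (share x)

  odometer-supersolution : ∀ N →
    Supersolution (initial N) (λ v → odometer (fold N share (length v)))
  odometer-supersolution N [] = begin
    N + (odometer N + ∑[ j < k ] odometer (share N))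
      ≡⟨ cong (λ n → N + (odometer N + n)) (∑-const k _) ⟩
    N + (odometer N + k * odometer (share N))
      ≡⟨ +-assoc N _ _ ⟨
    N + odometer N + k * odometer (share N)
      ≤⟨ odometer-balance N ⟩
    suc k * odometer N + k
      ∎
    where open ≤-Reasoning
  odometer-supersolution N (_ ∷ p) = begin
    odometer x + ∑[ j < k ] odometer (share (share x))
      ≡⟨ cong₂ _+_ (odometer-unfold x) (∑-const k _) ⟩
    share x + odometer (share x) + k * odometer (share (share x))
      ≤⟨ odometer-balance (share x) ⟩
    suc k * odometer (share x) + k
      ∎
    where
    open ≤-Reasoning
    x = fold N share (length p)

  module _ {N : ℕ} {y : Vertex k → ℕ} (sup : Supersolution (initial N) y) where

    -- w, receiving x chips net from above, is left stable by y; in Supersolution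
    -- x is N at the root and y (parent w) ∸ y w elsewhere.
    Absorbs : ℕ → Vertex k → Set
    Absorbs x w = x + ∑[ j < k ] y (j ∷ w) ≤ k * y w + k

    absorbs-root : Absorbs N []
    absorbs-root = +-cancelˡ-≤ (y []) _ _ (begin
      y [] + (N + Σ)               ≡⟨ x∙yz≈y∙xz (y []) N Σ ⟩
      N + (y [] + Σ)               ≤⟨ sup [] ⟩
      suc k * y [] + k             ≡⟨ +-assoc (y []) (k * y []) k ⟩
      y [] + (k * y [] + k)        ∎)
      where
      open ≤-Reasoning
      Σ = ∑[ j < k ] y (j ∷ [])

    absorbs-child : ∀ {x j p} → x + y (j ∷ p) ≤ y p → Absorbs x (j ∷ p)
    absorbs-child {x} {j} {p} x+y≤ = +-cancelˡ-≤ (y (j ∷ p)) _ _ (begin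
      y (j ∷ p) + (x + Σ)                ≡⟨ x∙yz≈yx∙z (y (j ∷ p)) x Σ ⟩
      x + y (j ∷ p) + Σ                  ≤⟨ +-monoˡ-≤ Σ x+y≤ ⟩
      y p + Σ                            ≤⟨ sup (j ∷ p) ⟩
      suc k * y (j ∷ p) + k              ≡⟨ +-assoc (y (j ∷ p)) (k * y (j ∷ p)) k ⟩
      y (j ∷ p) + (k * y (j ∷ p) + k)    ∎)
      where
      open ≤-Reasoning
      Σ = ∑[ i < k ] y (i ∷ j ∷ p)

    absorbs-descend : ∀ {x w} → Absorbs (suc x) w → ∃ λ j → share (suc x) + y (j ∷ w) ≤ y w
    absorbs-descend {x} {w} absorbs with ∃-below-average (λ j → y (j ∷ w))
    ... | j , k*yj≤Σ = j , share-+-≤ (≤-trans (+-monoʳ-≤ (suc x) k*yj≤Σ) absorbs)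

    odometerWithin-≤ : ∀ b {x w} → Absorbs x w → odometerWithin b x ≤ y w
    odometerWithin-≤ zero    _ = z≤n
    odometerWithin-≤ (suc b) {zero}  {w} _ =
      subst (_≤ y w) (sym (odometerWithin-0 (suc b))) z≤n
    odometerWithin-≤ (suc b) {suc x} {w} absorbs with absorbs-descend absorbs
    ... | j , descend = begin
      share (suc x) + odometerWithin b (share (suc x))
        ≤⟨ +-monoʳ-≤ _ (odometerWithin-≤ b (absorbs-child descend)) ⟩
      share (suc x) + y (j ∷ w)
        ≤⟨ descend ⟩
      y w
        ∎
      where open ≤-Reasoning

    odometer-≤-child : ∀ {x j p} → odometer x ≤ y p → odometer (share x) ≤ y (j ∷ p)
    odometer-≤-child {x} {j} {p} odometer≤ with share x + y (j ∷ p) ≤? y p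
    ... | yes descend = odometerWithin-≤ (share x) (absorbs-child descend)
    -- Otherwise the bound at the parent already forces the one at the child.
    ... | no ¬descend = <⇒≤ (+-cancelˡ-< (share x) _ _ (begin-strict
      share x + odometer (share x)      ≡⟨ odometer-unfold x ⟨
      odometer x                        ≤⟨ odometer≤ ⟩
      y p                               <⟨ ≰⇒> ¬descend ⟩
      share x + y (j ∷ p)               ∎))
      where open ≤-Reasoning

    odometer-≤-supersolution : ∀ v → odometer (fold N share (length v)) ≤ y v
    odometer-≤-supersolution []      = odometerWithin-≤ N absorbs-root
    odometer-≤-supersolution (_ ∷ p) =
      odometer-≤-child {fold N share (length p)} (odometer-≤-supersolution p)

  count≡odometer : ∀ {N vs c} → Fires (initial N) vs c → Stable c →
                   ∀ v → count v vs ≡ odometer (fold N share (length v))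
  count≡odometer fires stable v = ≤-antisym
    (least-action fires (odometer-supersolution _) v)
    (odometer-≤-supersolution (stable⇒supersolution fires stable) v)

  share-allOnes : ∀ q m → share (q + allOnes k (suc m)) ≡ q / k + allOnes k m
  share-allOnes q m = begin
    (q + suc (k * R) ∸ 1) / k       ≡⟨ cong (λ n → (n ∸ 1) / k) (+-suc q (k * R)) ⟩
    (q + k * R) / k                 ≡⟨ /-congˡ (cong (q +_) (*-comm k R)) ⟩
    (q + R * k) / k                 ≡⟨ +-distrib-/-∣ʳ q (n∣m*n R) ⟩
    q / k + R * k / k               ≡⟨ cong (q / k +_) (m*n/n≡m R k) ⟩
    q / k + R                       ∎
    where
    open ≡-Reasoning
    R = allOnes k m

  _/k^_ : ℕ → ℕ → ℕ
  x /k^ i = _/_ x (k ^ i) {{m^n≢0 k i}}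

  /k^-suc : ∀ x i → x /k^ i / k ≡ x /k^ suc i
  /k^-suc x i = trans (m/n/o≡m/[n*o] x (k ^ i) k) (/-congʳ (*-comm (k ^ i) k))
    where instance
      _ = m^n≢0 k i
      _ = m^n≢0 k (suc i)
      _ = m*n≢0 (k ^ i) k

  iterated-share : ∀ {N n} i → allOnes k n ≤ N → i ≤ n →
                   fold N share i ≡ (N ∸ allOnes k n) /k^ i + allOnes k (n ∸ i)
  iterated-share {N} {n} zero R≤N _ =
    trans (sym (m∸n+n≡m R≤N)) (cong (_+ allOnes k n) (sym (n/1≡n _)))
  iterated-share {N} {n} (suc i) R≤N i<n = begin
    share (fold N share i)
      ≡⟨ cong share (iterated-share i R≤N (<⇒≤ i<n)) ⟩
    share (x /k^ i + allOnes k (n ∸ i))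
      ≡⟨ cong (λ m → share (x /k^ i + allOnes k m)) (+-∸-assoc 1 i<n) ⟩
    share (x /k^ i + allOnes k (suc (n ∸ suc i)))
      ≡⟨ share-allOnes (x /k^ i) (n ∸ suc i) ⟩
    x /k^ i / k + allOnes k (n ∸ suc i)
      ≡⟨ cong (_+ allOnes k (n ∸ suc i)) (/k^-suc x i) ⟩
    x /k^ suc i + allOnes k (n ∸ suc i)
      ∎
    where
    open ≡-Reasoning
    x = N ∸ allOnes k n

mainTheorem5 : (k N n : ℕ) (hk : 2 ≤ k) → 1 ≤ N →
    k ^ n ≤ N * (k ∸ 1) + 1 → N * (k ∸ 1) + 1 < k ^ suc n →
    ∀ (i : ℕ) → i < n →
    ∀ (vs : List (Vertex k)) (c : Config k) →
    Fires (initial N) vs c → Stable c →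
    ∀ (ws : List (Vertex k)) (d : Config k) →
    Fires (initial (divPow k hk (N ∸ repunit k hk n) i + repunit k hk (n ∸ i))) ws d →
    Stable d →
    ∀ (v : Vertex k) → length v ≡ i → count v vs ≡ count [] ws
mainTheorem5 k N n hk@(s≤s (s≤s z≤n)) _ k^n≤ _ i i<n vs c fires stable ws d fires′ stable′ v refl =
  begin
    count v vs
      ≡⟨ count≡odometer fires stable v ⟩
    odometer (fold N share i)
      ≡⟨ cong odometer (iterated-share i (allOnes-≤ {n = n} k^n≤) (<⇒≤ i<n)) ⟩
    odometer ((N ∸ allOnes k n) /k^ i + allOnes k (n ∸ i))
      ≡⟨ cong₂ (λ a b → odometer ((N ∸ a) /k^ i + b))
               (repunit≡allOnes hk n) (repunit≡allOnes hk (n ∸ i)) ⟨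
    odometer (divPow k hk (N ∸ repunit k hk n) i + repunit k hk (n ∸ i))
      ≡⟨ count≡odometer fires′ stable′ [] ⟨
    count [] ws
      ∎
  where
  open Odometer k
  open ≡-Reasoning
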